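{- Let $A$ be an integer $m\times n$ matrix, $b\in\mathbb{Z}^m$, $l,u\in\mathbb{Z}^n$, and $S:=\{x\in\mathbb{Z}^n : Ax=b,\ l\le x\le u\}$. Then $\|\mathcal{G}(A)\|_1$ is an upper bound on $e(S)$.
   Context: Define a partial order $\sqsubseteq$ on $\mathbb{R}^n$ by $x\sqsubseteq y$ if $x_iy_i\ge0$ and $|x_i|\le|y_i|$ for all $i$. The Graver basis $\mathcal{G}(A)\subset\mathbb{Z}^n$ of an integer matrix $A$ is the (finite) set of $\sqsubseteq$-minimal elements of $\{x\in\mathbb{Z}^n : Ax=0,\ x\ne0\}$, and $\|\mathcal{G}(A)\|_1:=\max\{\|x\|_1 : x\in\mathcal{G}(A)\}$. The edge complexity $e(S)$ of a finite set $S\subset\mathbb{Z}^n$ is the smallest nonnegative integer such that every edge of ${\rm conv}(S)$ is parallel to some integer vector $v$ with $\|v\|_1\le e(S)$. -}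

module Defs where

open import Data.Nat using (ℕ; zero; suc) renaming (_+_ to _+ℕ_; _≤_ to _≤ℕ_)
open import Data.Integer using (ℤ; 0ℤ; _+_; _-_; _*_; _≤_; ∣_∣)
open import Data.Fin using (Fin; zero; suc)
open import Data.Product using (_×_; ∃; ∃-syntax)
open import Function using (_∘_)
open import Relation.Binary.PropositionalEquality using (_≡_; _≢_)
open import Relation.Nullary using (¬_)

Vecℤ : ℕ → Set
Vecℤ n = Fin n → ℤ

Matℤ : ℕ → ℕ → Set
Matℤ m n = Fin m → Fin n → ℤ

dot : ∀ {n} → Vecℤ n → Vecℤ n → ℤ
dot {zero}  _ _ = 0ℤ
dot {suc n} x y = x zero * y zero + dot (x ∘ suc) (y ∘ suc)

norm1 : ∀ {n} → Vecℤ n → ℕ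
norm1 {zero}  _ = 0
norm1 {suc n} x = ∣ x zero ∣ +ℕ norm1 (x ∘ suc)

_-v_ : ∀ {n} → Vecℤ n → Vecℤ n → Vecℤ n
(x -v y) i = x i - y i

_·v_ : ∀ {n} → ℤ → Vecℤ n → Vecℤ n
(k ·v x) i = k * x i

_≐_ : ∀ {n} → Vecℤ n → Vecℤ n → Set
x ≐ y = ∀ i → x i ≡ y i

NonZero : ∀ {n} → Vecℤ n → Set
NonZero x = ∃[ i ] (x i ≢ 0ℤ)

InKernel : ∀ {m n} → Matℤ m n → Vecℤ n → Set
InKernel A x = ∀ i → dot (A i) x ≡ 0ℤ

_⊑_ : ∀ {n} → Vecℤ n → Vecℤ n → Set
x ⊑ y = ∀ i → (0ℤ ≤ x i * y i) × (∣ x i ∣ ≤ℕ ∣ y i ∣)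

InGraver : ∀ {m n} → Matℤ m n → Vecℤ n → Set
InGraver A g =
  InKernel A g × NonZero g ×
  (∀ x → InKernel A x → NonZero x → x ⊑ g → x ≐ g)

InS : ∀ {m n} → Matℤ m n → Vecℤ m → Vecℤ n → Vecℤ n → Vecℤ n → Set
InS A b l u x = (∀ i → dot (A i) x ≡ b i) × (∀ j → (l j ≤ x j) × (x j ≤ u j))

OnLine : ∀ {n} → Vecℤ n → Vecℤ n → Vecℤ n → Set
OnLine x y z = ∃[ p ] ∃[ q ] ((q ≢ 0ℤ) × ((q ·v (z -v x)) ≐ (p ·v (y -v x))))

-- For a finite set S ⊆ ℤ^n (given by a predicate), the segment [x,y] spans
-- an edge of conv(S) exposed by the (integer) linear functional c:
-- x, y ∈ S distinct, both maximize c over S, and all maximizers of c over S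
-- are collinear with x and y (so the face conv(argmax) is 1-dimensional,
-- with direction y - x).
IsEdge : ∀ {n} → (Vecℤ n → Set) → Vecℤ n → Vecℤ n → Vecℤ n → Set
IsEdge S c x y =
  S x × S y × NonZero (y -v x) × dot c x ≡ dot c y ×
  (∀ z → S z → dot c z ≤ dot c x) ×
  (∀ z → S z → dot c z ≡ dot c x → OnLine x y z)

Parallel : ∀ {n} → Vecℤ n → Vecℤ n → Set
Parallel w v = ∃[ p ] ∃[ q ] ((p ≢ 0ℤ) × (q ≢ 0ℤ) × ((q ·v w) ≐ (p ·v v)))

EdgeComplexityAtMost : ∀ {n} → (Vecℤ n → Set) → ℕ → Set
EdgeComplexityAtMost S K =
  ∀ c x y → IsEdge S c x y → ∃[ v ] (Parallel (y -v x) v × norm1 v ≤ℕ K)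

GraverNormAtMost : ∀ {m n} → Matℤ m n → ℕ → Set
GraverNormAtMost A K = ∀ g → InGraver A g → norm1 g ≤ℕ K

-- Let x, y be the endpoints of an edge of conv(S) exposed by c. The difference y − x lies in
-- ker A, so it dominates some Graver element g ⊑ y − x (descend along ⊑, which strictly
-- decreases the 1-norm). Conformality means every coordinate of g lies between 0 and
-- y_j − x_j, hence x + g and y − g satisfy the bounds l ≤ · ≤ u as well as A · = b, i.e. both
-- lie in S. Maximality of c at x and at y then forces c·g ≤ 0 ≤ c·g, so x + g is again
-- a maximizer, hence on the edge: g is parallel to y − x and ‖g‖₁ ≤ ‖𝒢(A)‖₁.
module Submission where

open import Defs
open import Data.Nat using (ℕ; zero; suc; s≤s; s≤s⁻¹; _<_)
import Data.Nat as ℕ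
import Data.Nat.Properties as ℕ
open import Data.Nat.Induction using (<-wellFounded)
open import Data.Integer
  using (ℤ; +_; -[1+_]; 0ℤ; _+_; _-_; _*_; -_; _≤_; ∣_∣; +≤+; -≤+; -≤-; _≤?_; _≟_)
open import Data.Integer.Properties
  using (≤-refl; ≤-trans; ≤-antisym; ≤-total; +-monoʳ-≤; neg-mono-≤; neg-cancel-≤;
         +-identityʳ; +-inverseʳ; ∣-i∣≡∣i∣; i*j≡0⇒i≡0∨j≡0; i≤j⇒i-j≤0)
open import Data.Integer.Tactic.RingSolver using (solve-∀)
open import Data.Fin using (Fin; zero; suc)
open import Data.Fin.Properties using (all?; any?)
open import Data.Vec.Functional using ([]; _∷_; head; tail)
open import Data.Product using (_×_; _,_; proj₁; proj₂; ∃-syntax)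
open import Data.Sum using (_⊎_; inj₁; inj₂)
open import Function using (_∘_)
open import Induction.WellFounded using (Acc; acc)
open import Relation.Binary.Definitions using (_Respects_)
open import Relation.Binary.PropositionalEquality
open import Relation.Nullary using (Dec; yes; no; ¬_; contradiction)
open import Relation.Nullary.Decidable using (map′; _×-dec_; _⊎-dec_; ¬?)
open import Relation.Unary using (Decidable)

_+v_ : ∀ {n} → Vecℤ n → Vecℤ n → Vecℤ n
(x +v y) i = x i + y i

Solves : ∀ {m n} → Matℤ m n → Vecℤ m → Vecℤ n → Set
Solves A b x = ∀ i → dot (A i) x ≡ b i

Between : ℤ → ℤ → ℤ → Set
Between a b w = (a ≤ w × w ≤ b) ⊎ (b ≤ w × w ≤ a)

Conformal : ℤ → ℤ → Set
Conformal a c = (0ℤ ≤ a * c) × (∣ a ∣ ℕ.≤ ∣ c ∣)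

Box : ∀ {n} → (Fin n → ℕ) → Vecℤ n → Set
Box B x = ∀ i → ∣ x i ∣ ℕ.≤ B i

Between-refl : ∀ a b → Between a b b
Between-refl a b with ≤-total a b
... | inj₁ a≤b = inj₁ (a≤b , ≤-refl)
... | inj₂ b≤a = inj₂ (≤-refl , b≤a)

Between-trans : ∀ {a b c w} → Between a b c → Between a c w → Between a b w
Between-trans (inj₁ (a≤c , c≤b)) (inj₁ (a≤w , w≤c)) = inj₁ (a≤w , ≤-trans w≤c c≤b)
Between-trans (inj₁ (a≤c , c≤b)) (inj₂ (c≤w , w≤a)) =
  inj₁ (≤-trans a≤c c≤w , ≤-trans w≤a (≤-trans a≤c c≤b))
Between-trans (inj₂ (b≤c , c≤a)) (inj₁ (a≤w , w≤c)) =
  inj₂ (≤-trans b≤c (≤-trans c≤a a≤w) , ≤-trans w≤c c≤a)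
Between-trans (inj₂ (b≤c , c≤a)) (inj₂ (c≤w , w≤a)) = inj₂ (≤-trans b≤c c≤w , w≤a)

Between-sym : ∀ {a b w} → Between a b w → Between b a w
Between-sym (inj₁ p) = inj₂ p
Between-sym (inj₂ p) = inj₁ p

Between-+ˡ : ∀ t {a b w} → Between a b w → Between (t + a) (t + b) (t + w)
Between-+ˡ t (inj₁ (a≤w , w≤b)) = inj₁ (+-monoʳ-≤ t a≤w , +-monoʳ-≤ t w≤b)
Between-+ˡ t (inj₂ (b≤w , w≤a)) = inj₂ (+-monoʳ-≤ t b≤w , +-monoʳ-≤ t w≤a)

Between-neg : ∀ {a b w} → Between a b w → Between (- a) (- b) (- w)
Between-neg (inj₁ (a≤w , w≤b)) = inj₂ (neg-mono-≤ w≤b , neg-mono-≤ a≤w)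
Between-neg (inj₂ (b≤w , w≤a)) = inj₁ (neg-mono-≤ w≤a , neg-mono-≤ b≤w)

Between-within : ∀ {l u a b w} → l ≤ a × a ≤ u → l ≤ b × b ≤ u → Between a b w → l ≤ w × w ≤ u
Between-within (l≤a , _) (_ , b≤u) (inj₁ (a≤w , w≤b)) = ≤-trans l≤a a≤w , ≤-trans w≤b b≤u
Between-within (_ , a≤u) (l≤b , _) (inj₂ (b≤w , w≤a)) = ≤-trans l≤b b≤w , ≤-trans w≤a a≤u

Between-step-forward : ∀ x y g → Between 0ℤ (y - x) g → Between x y (x + g)
Between-step-forward x y g h =
  subst₂ (λ a b → Between a b (x + g)) (+-identityʳ x) (x+[y-x]≡y x y) (Between-+ˡ x h)
  where
  x+[y-x]≡y : ∀ x y → x + (y - x) ≡ y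
  x+[y-x]≡y = solve-∀

Between-step-backward : ∀ x y g → Between 0ℤ (y - x) g → Between x y (y - g)
Between-step-backward x y g h =
  Between-sym (subst₂ (λ a b → Between a b (y - g)) (+-identityʳ y) (y-[y-x]≡x x y)
                      (Between-+ˡ y (Between-neg h)))
  where
  y-[y-x]≡x : ∀ x y → y - (y - x) ≡ x
  y-[y-x]≡x = solve-∀

conformal⇒Between : ∀ a c → Conformal a c → Between 0ℤ c a
conformal⇒Between (+ zero)  (+ _)     _ = inj₁ (≤-refl , +≤+ ℕ.z≤n)
conformal⇒Between (+ suc _) (+ _)     (_ , a≤c) = inj₁ (+≤+ ℕ.z≤n , +≤+ a≤c)
conformal⇒Between (+ zero)  (-[1+ _ ]) _ = inj₂ (-≤+ , ≤-refl)
conformal⇒Between (+ suc _) (-[1+ _ ]) (() , _)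
conformal⇒Between (-[1+ _ ]) (+ zero)  (_ , ())
conformal⇒Between (-[1+ _ ]) (+ suc _) (() , _)
conformal⇒Between (-[1+ _ ]) (-[1+ _ ]) (_ , s≤s a≤c) = inj₂ (-≤- a≤c , -≤+)

Between⇒conformal : ∀ a c → Between 0ℤ c a → Conformal a c
Between⇒conformal (+ zero)  _          _ = +≤+ ℕ.z≤n , ℕ.z≤n
Between⇒conformal (+ suc _) (+ suc _) (inj₁ (_ , +≤+ a≤c)) = +≤+ ℕ.z≤n , a≤c
Between⇒conformal (+ suc _) (+ zero)  (inj₁ (_ , +≤+ ()))
Between⇒conformal (+ suc _) (-[1+ _ ]) (inj₁ (_ , ()))
Between⇒conformal (+ suc _) _          (inj₂ (_ , +≤+ ()))
Between⇒conformal (-[1+ _ ]) _        (inj₁ (() , _))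
Between⇒conformal (-[1+ _ ]) (+ _)     (inj₂ (() , _))
Between⇒conformal (-[1+ _ ]) (-[1+ _ ]) (inj₂ (-≤- c≤a , _)) = +≤+ ℕ.z≤n , s≤s c≤a

conformal∧∣∣≡⇒≡ : ∀ a c → Conformal a c → ∣ a ∣ ≡ ∣ c ∣ → a ≡ c
conformal∧∣∣≡⇒≡ (+ _)      (+ _)      _ eq = cong +_ eq
conformal∧∣∣≡⇒≡ (+ zero)   (-[1+ _ ]) _ ()
conformal∧∣∣≡⇒≡ (+ suc _)  (-[1+ _ ]) (() , _) _
conformal∧∣∣≡⇒≡ (-[1+ _ ]) (+ zero)   _ ()
conformal∧∣∣≡⇒≡ (-[1+ _ ]) (+ suc _)  (() , _) _
conformal∧∣∣≡⇒≡ (-[1+ _ ]) (-[1+ _ ]) _ eq = cong -[1+_] (ℕ.suc-injective eq)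

⊑-refl : ∀ {n} (x : Vecℤ n) → x ⊑ x
⊑-refl x i = Between⇒conformal (x i) (x i) (Between-refl 0ℤ (x i))

⊑-trans : ∀ {n} {x y z : Vecℤ n} → x ⊑ y → y ⊑ z → x ⊑ z
⊑-trans {x = x} {y} {z} x⊑y y⊑z i =
  Between⇒conformal (x i) (z i)
    (Between-trans (conformal⇒Between (y i) (z i) (y⊑z i)) (conformal⇒Between (x i) (y i) (x⊑y i)))

_⊑?_ : ∀ {n} (x y : Vecℤ n) → Dec (x ⊑ y)
x ⊑? y = all? (λ i → (0ℤ ≤? x i * y i) ×-dec (∣ x i ∣ ℕ.≤? ∣ y i ∣))

⊑-respˡ : ∀ {n} (y : Vecℤ n) → (_⊑ y) Respects _≐_
⊑-respˡ y x≐x′ x⊑y i = subst (λ t → Conformal t (y i)) (x≐x′ i) (x⊑y i)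

⊑⇒Box : ∀ {n} {x y : Vecℤ n} → x ⊑ y → Box (∣_∣ ∘ y) x
⊑⇒Box x⊑y = proj₂ ∘ x⊑y

norm1-cong : ∀ {n} {x y : Vecℤ n} → x ≐ y → norm1 x ≡ norm1 y
norm1-cong {zero}  _   = refl
norm1-cong {suc n} x≐y = cong₂ ℕ._+_ (cong ∣_∣ (x≐y zero)) (norm1-cong (x≐y ∘ suc))

norm1-mono-⊑ : ∀ {n} {x y : Vecℤ n} → x ⊑ y → norm1 x ℕ.≤ norm1 y
norm1-mono-⊑ {zero}  _   = ℕ.z≤n
norm1-mono-⊑ {suc n} x⊑y = ℕ.+-mono-≤ (proj₂ (x⊑y zero)) (norm1-mono-⊑ (x⊑y ∘ suc))

+-mono-≤-equality : ∀ {a b c d} → a ℕ.≤ b → c ℕ.≤ d → b ℕ.+ d ℕ.≤ a ℕ.+ c → a ≡ b × c ≡ d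
+-mono-≤-equality {a} {b} {c} {d} a≤b c≤d b+d≤a+c =
  ℕ.≤-antisym a≤b (ℕ.+-cancelʳ-≤ d b a (ℕ.≤-trans b+d≤a+c (ℕ.+-monoʳ-≤ a c≤d))) ,
  ℕ.≤-antisym c≤d (ℕ.+-cancelˡ-≤ b d c (ℕ.≤-trans b+d≤a+c (ℕ.+-monoˡ-≤ c a≤b)))

⊑∧norm1≥⇒≐ : ∀ {n} {x y : Vecℤ n} → x ⊑ y → norm1 y ℕ.≤ norm1 x → x ≐ y
⊑∧norm1≥⇒≐ {suc n} {x} {y} x⊑y y≤x
  with +-mono-≤-equality (proj₂ (x⊑y zero)) (norm1-mono-⊑ {x = x ∘ suc} {y ∘ suc} (x⊑y ∘ suc)) y≤x
... | head≡ , tail≡ = λ where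
  zero    → conformal∧∣∣≡⇒≡ (x zero) (y zero) (x⊑y zero) head≡
  (suc i) → ⊑∧norm1≥⇒≐ {x = x ∘ suc} {y ∘ suc} (x⊑y ∘ suc) (ℕ.≤-reflexive (sym tail≡)) i

dot-cong : ∀ {n} (c : Vecℤ n) {x y : Vecℤ n} → x ≐ y → dot c x ≡ dot c y
dot-cong {zero}  c _   = refl
dot-cong {suc n} c x≐y = cong₂ _+_ (cong (c zero *_) (x≐y zero)) (dot-cong (c ∘ suc) (x≐y ∘ suc))

dot-distribˡ-+v : ∀ {n} (c x y : Vecℤ n) → dot c (x +v y) ≡ dot c x + dot c y
dot-distribˡ-+v {zero}  c x y = refl
dot-distribˡ-+v {suc n} c x y =
  trans (cong (_+_ (c zero * (x zero + y zero))) (dot-distribˡ-+v (c ∘ suc) (x ∘ suc) (y ∘ suc)))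
        (interchange (c zero) (x zero) (y zero) _ _)
  where
  interchange : ∀ a b d X Y → a * (b + d) + (X + Y) ≡ (a * b + X) + (a * d + Y)
  interchange = solve-∀

dot-distribˡ--v : ∀ {n} (c x y : Vecℤ n) → dot c (x -v y) ≡ dot c x - dot c y
dot-distribˡ--v {zero}  c x y = refl
dot-distribˡ--v {suc n} c x y =
  trans (cong (_+_ (c zero * (x zero - y zero))) (dot-distribˡ--v (c ∘ suc) (x ∘ suc) (y ∘ suc)))
        (interchange (c zero) (x zero) (y zero) _ _)
  where
  interchange : ∀ a b d X Y → a * (b - d) + (X - Y) ≡ (a * b + X) - (a * d + Y)
  interchange = solve-∀

InKernel? : ∀ {m n} (A : Matℤ m n) (x : Vecℤ n) → Dec (InKernel A x)
InKernel? A x = all? (λ i → dot (A i) x ≟ 0ℤ)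

InKernel-resp : ∀ {m n} (A : Matℤ m n) → InKernel A Respects _≐_
InKernel-resp A x≐y Ax≡0 i = trans (sym (dot-cong (A i) x≐y)) (Ax≡0 i)

NonZero? : ∀ {n} (x : Vecℤ n) → Dec (NonZero x)
NonZero? x = any? (λ i → ¬? (x i ≟ 0ℤ))

NonZero-resp : ∀ {n} → NonZero {n} Respects _≐_
NonZero-resp x≐y (i , xi≢0) = i , xi≢0 ∘ trans (x≐y i)

Solves-difference : ∀ {m n} {A : Matℤ m n} {b x y} → Solves A b x → Solves A b y →
                    InKernel A (y -v x)
Solves-difference {A = A} {b} {x} {y} Ax≡b Ay≡b i = begin
  dot (A i) (y -v x)        ≡⟨ dot-distribˡ--v (A i) y x ⟩
  dot (A i) y - dot (A i) x ≡⟨ cong₂ _-_ (Ay≡b i) (Ax≡b i) ⟩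
  b i - b i                 ≡⟨ +-inverseʳ (b i) ⟩
  0ℤ                        ∎
  where open ≡-Reasoning

Solves-+v-kernel : ∀ {m n} {A : Matℤ m n} {b x g} → Solves A b x → InKernel A g → Solves A b (x +v g)
Solves-+v-kernel {A = A} {b} {x} {g} Ax≡b Ag≡0 i = begin
  dot (A i) (x +v g)        ≡⟨ dot-distribˡ-+v (A i) x g ⟩
  dot (A i) x + dot (A i) g ≡⟨ cong₂ _+_ (Ax≡b i) (Ag≡0 i) ⟩
  b i + 0ℤ                  ≡⟨ +-identityʳ (b i) ⟩
  b i                       ∎
  where open ≡-Reasoning

Solves--v-kernel : ∀ {m n} {A : Matℤ m n} {b x g} → Solves A b x → InKernel A g → Solves A b (x -v g)
Solves--v-kernel {A = A} {b} {x} {g} Ax≡b Ag≡0 i = begin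
  dot (A i) (x -v g)        ≡⟨ dot-distribˡ--v (A i) x g ⟩
  dot (A i) x - dot (A i) g ≡⟨ cong₂ _-_ (Ax≡b i) (Ag≡0 i) ⟩
  b i - 0ℤ                  ≡⟨ +-identityʳ (b i) ⟩
  b i                       ∎
  where open ≡-Reasoning

InS-+v-conformal : ∀ {m n} {A : Matℤ m n} {b l u x y g} →
  InS A b l u x → InS A b l u y → InKernel A g → g ⊑ (y -v x) → InS A b l u (x +v g)
InS-+v-conformal {A = A} {b} {x = x} {y} {g} (Ax≡b , x∈box) (_ , y∈box) Ag≡0 g⊑y-x =
  Solves-+v-kernel {A = A} {b} {x} {g} Ax≡b Ag≡0 ,
  λ j → Between-within (x∈box j) (y∈box j)
          (Between-step-forward (x j) (y j) (g j) (conformal⇒Between (g j) (y j - x j) (g⊑y-x j)))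

InS--v-conformal : ∀ {m n} {A : Matℤ m n} {b l u x y g} →
  InS A b l u x → InS A b l u y → InKernel A g → g ⊑ (y -v x) → InS A b l u (y -v g)
InS--v-conformal {A = A} {b} {x = x} {y} {g} (_ , x∈box) (Ay≡b , y∈box) Ag≡0 g⊑y-x =
  Solves--v-kernel {A = A} {b} {y} {g} Ay≡b Ag≡0 ,
  λ j → Between-within (x∈box j) (y∈box j)
          (Between-step-backward (x j) (y j) (g j) (conformal⇒Between (g j) (y j - x j) (g⊑y-x j)))

∃-∣∣≤? : ∀ {Q : ℤ → Set} → Decidable Q → ∀ M → Dec (∃[ a ] (∣ a ∣ ℕ.≤ M × Q a))
∃-∣∣≤? {Q} Q? M = map′ fromUpTo toUpTo (ℕ.anyUpTo? (λ k → Q? (+ k) ⊎-dec Q? (- + k)) (suc M))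
  where
  fromUpTo : ∃[ k ] (k < suc M × (Q (+ k) ⊎ Q (- + k))) → ∃[ a ] (∣ a ∣ ℕ.≤ M × Q a)
  fromUpTo (k , k<1+M , inj₁ q) = + k , s≤s⁻¹ k<1+M , q
  fromUpTo (k , k<1+M , inj₂ q) = - + k , subst (ℕ._≤ M) (sym (∣-i∣≡∣i∣ (+ k))) (s≤s⁻¹ k<1+M) , q
  toUpTo : ∃[ a ] (∣ a ∣ ℕ.≤ M × Q a) → ∃[ k ] (k < suc M × (Q (+ k) ⊎ Q (- + k)))
  toUpTo (+ k      , k≤M , q) = k , s≤s k≤M , inj₁ q
  toUpTo (-[1+ k ] , k<M , q) = suc k , s≤s k<M , inj₂ q

∃-Box? : ∀ {n} {P : Vecℤ n → Set} → Decidable P → P Respects _≐_ →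
         ∀ B → Dec (∃[ x ] (Box B x × P x))
∃-Box? {zero}  {P} P? P-resp B =
  map′ (λ p → [] , (λ ()) , p) (λ (x , _ , p) → P-resp {x} {[]} (λ ()) p) (P? [])
∃-Box? {suc n} {P} P? P-resp B = map′ fromCons toCons
  (∃-∣∣≤? (λ a → ∃-Box? (P? ∘ (a ∷_)) (P-resp ∘ cons-cong a) (tail B)) (head B))
  where
  cons-cong : ∀ a {r r′ : Vecℤ n} → r ≐ r′ → (a ∷ r) ≐ (a ∷ r′)
  cons-cong a r≐r′ zero    = refl
  cons-cong a r≐r′ (suc i) = r≐r′ i
  fromCons : ∃[ a ] (∣ a ∣ ℕ.≤ head B × ∃[ r ] (Box (tail B) r × P (a ∷ r))) →
             ∃[ x ] (Box B x × P x)
  fromCons (a , a≤ , r , r∈box , p) = a ∷ r , (λ { zero → a≤ ; (suc i) → r∈box i }) , p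
  toCons : ∃[ x ] (Box B x × P x) →
           ∃[ a ] (∣ a ∣ ℕ.≤ head B × ∃[ r ] (Box (tail B) r × P (a ∷ r)))
  toCons (x , x∈box , p) =
    head x , x∈box zero , tail x , x∈box ∘ suc , P-resp (λ { zero → refl ; (suc i) → refl }) p

module _ {m n} (A : Matℤ m n) where

  StrictKernelPart : Vecℤ n → Vecℤ n → Set
  StrictKernelPart d x = InKernel A x × NonZero x × x ⊑ d × norm1 x < norm1 d

  StrictKernelPart? : ∀ d → Decidable (StrictKernelPart d)
  StrictKernelPart? d x = InKernel? A x ×-dec NonZero? x ×-dec x ⊑? d ×-dec norm1 x ℕ.<? norm1 d

  StrictKernelPart-resp : ∀ d → StrictKernelPart d Respects _≐_
  StrictKernelPart-resp d x≐y (Ax≡0 , x≢0 , x⊑d , x<d) =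
    InKernel-resp A x≐y Ax≡0 , NonZero-resp x≐y x≢0 , ⊑-respˡ d x≐y x⊑d ,
    subst (_< norm1 d) (norm1-cong x≐y) x<d

  graver-below-acc : ∀ d → Acc _<_ (norm1 d) → InKernel A d → NonZero d →
                     ∃[ g ] (InGraver A g × g ⊑ d)
  graver-below-acc d (acc rec) Ad≡0 d≢0
    with ∃-Box? (StrictKernelPart? d) (StrictKernelPart-resp d) (∣_∣ ∘ d)
  ... | yes (x , _ , Ax≡0 , x≢0 , x⊑d , x<d) =
    let g , g∈𝒢 , g⊑x = graver-below-acc x (rec x<d) Ax≡0 x≢0
    in  g , g∈𝒢 , ⊑-trans {x = g} {x} {d} g⊑x x⊑d
  ... | no ¬part = d , (Ad≡0 , d≢0 , minimal) , ⊑-refl d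
    where
    minimal : ∀ x → InKernel A x → NonZero x → x ⊑ d → x ≐ d
    minimal x Ax≡0 x≢0 x⊑d with norm1 x ℕ.<? norm1 d
    ... | yes x<d = contradiction (x , ⊑⇒Box {x = x} {d} x⊑d , Ax≡0 , x≢0 , x⊑d , x<d) ¬part
    ... | no x≮d  = ⊑∧norm1≥⇒≐ x⊑d (ℕ.≮⇒≥ x≮d)

  graver-below : ∀ {d} → InKernel A d → NonZero d → ∃[ g ] (InGraver A g × g ⊑ d)
  graver-below {d} = graver-below-acc d (<-wellFounded (norm1 d))

i+j≤i⇒j≤0 : ∀ i j → i + j ≤ i → j ≤ 0ℤ
i+j≤i⇒j≤0 i j i+j≤i = subst (_≤ 0ℤ) ([i+j]-i≡j i j) (i≤j⇒i-j≤0 i+j≤i)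
  where
  [i+j]-i≡j : ∀ i j → (i + j) - i ≡ j
  [i+j]-i≡j = solve-∀

OnLine-+v⇒Parallel : ∀ {n} {x y g : Vecℤ n} → OnLine x y (x +v g) → NonZero g → Parallel (y -v x) g
OnLine-+v⇒Parallel {x = x} {y} {g} (p , q , q≢0 , q[x+g-x]≐p[y-x]) (j , gj≢0) =
  q , p , q≢0 , p≢0 , p[y-x]≐qg
  where
  [x+g]-x≡g : ∀ x g → (x + g) - x ≡ g
  [x+g]-x≡g = solve-∀
  p[y-x]≐qg : (p ·v (y -v x)) ≐ (q ·v g)
  p[y-x]≐qg i = trans (sym (q[x+g-x]≐p[y-x] i)) (cong (q *_) ([x+g]-x≡g (x i) (g i)))
  p≢0 : ¬ p ≡ 0ℤ
  p≢0 refl with i*j≡0⇒i≡0∨j≡0 q (sym (p[y-x]≐qg j))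
  ... | inj₁ q≡0  = q≢0 q≡0
  ... | inj₂ gj≡0 = gj≢0 gj≡0

lemma5p1 : ∀ {m n} (A : Matℤ m n) (b : Vecℤ m) (l u : Vecℤ n) (K : ℕ) →
    GraverNormAtMost A K →
    EdgeComplexityAtMost (InS A b l u) K
lemma5p1 A b l u K ‖𝒢‖≤K c x y (x∈S , y∈S , y-x≢0 , cx≡cy , c-max , maxima-on-line)
  with graver-below A (Solves-difference {A = A} {b} {x} {y} (proj₁ x∈S) (proj₁ y∈S)) y-x≢0
... | g , g∈𝒢@(Ag≡0 , g≢0 , _) , g⊑y-x =
  g , OnLine-+v⇒Parallel {x = x} {y} {g} (maxima-on-line _ x+g∈S cx+g≡cx) g≢0 , ‖𝒢‖≤K g g∈𝒢
  where
  x+g∈S : InS A b l u (x +v g)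
  x+g∈S = InS-+v-conformal x∈S y∈S Ag≡0 g⊑y-x
  y-g∈S : InS A b l u (y -v g)
  y-g∈S = InS--v-conformal x∈S y∈S Ag≡0 g⊑y-x
  cg≤0 : dot c g ≤ 0ℤ
  cg≤0 = i+j≤i⇒j≤0 (dot c x) (dot c g) (subst (_≤ dot c x) (dot-distribˡ-+v c x g) (c-max _ x+g∈S))
  cg≥0 : 0ℤ ≤ dot c g
  cg≥0 = neg-cancel-≤ (i+j≤i⇒j≤0 (dot c y) (- dot c g)
           (subst₂ _≤_ (dot-distribˡ--v c y g) cx≡cy (c-max _ y-g∈S)))
  cx+g≡cx : dot c (x +v g) ≡ dot c x
  cx+g≡cx = begin
    dot c (x +v g)      ≡⟨ dot-distribˡ-+v c x g ⟩
    dot c x + dot c g   ≡⟨ cong (_+_ (dot c x)) (≤-antisym cg≤0 cg≥0) ⟩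
    dot c x + 0ℤ        ≡⟨ +-identityʳ (dot c x) ⟩
    dot c x             ∎
    where open ≡-Reasoning
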